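{- Let $T$ be a tree. Then for every dominating set $S$ of $T$, $|a(S)|\ge 2\gamma(T)-|S|$.
   Context: A dominating set of a graph $G=(V,E)$ is a set $S\subseteq V$ such that every vertex is in $S$ or adjacent to a vertex of $S$. $\gamma(G)$ denotes the minimum size of a dominating set. For a dominating set $S$, $a(S)=\{v\in S: S\setminus\{v\}\text{ is not a dominating set}\}$ is the set of critical vertices of $S$. -}

module Defs where

open import Data.Nat using (ℕ; suc; _≤_)
open import Data.Bool using (Bool; T)
open import Data.Fin using (Fin)
open import Data.Fin.Subset using (Subset; _∈_; _-_)
open import Data.List using (List; []; _∷_)
open import Data.List.Relation.Unary.Unique.Propositional using (Unique)
open import Data.Product using (Σ; _×_; ∃; ∃-syntax)
open import Data.Sum using (_⊎_)
open import Data.Empty using (⊥)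
open import Relation.Nullary using (¬_)
open import Relation.Binary.PropositionalEquality using (_≡_)

record Graph (n : ℕ) : Set where
  field
    adj    : Fin n → Fin n → Bool
    sym    : ∀ u v → adj u v ≡ adj v u
    irrefl : ∀ v → adj v v ≡ Data.Bool.false

open Graph public

Adj : ∀ {n} → Graph n → Fin n → Fin n → Set
Adj G u v = T (adj G u v)

data WalkFrom {n} (G : Graph n) : Fin n → List (Fin n) → Set where
  single : ∀ v → WalkFrom G v (v ∷ [])
  step   : ∀ {u w ws} → Adj G u w → WalkFrom G w (w ∷ ws) → WalkFrom G u (u ∷ w ∷ ws)

last : ∀ {A : Set} → A → List A → A
last a [] = a
last a (b ∷ bs) = last b bs

Connected : ∀ {n} → Graph n → Set
Connected {n} G = ∀ (u v : Fin n) →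
  ∃[ vs ] (WalkFrom G u (u ∷ vs) × last u vs ≡ v)

record Cycle {n} (G : Graph n) : Set where
  field
    v₀    : Fin n
    rest  : List (Fin n)
    long  : 2 ≤ Data.List.length rest
    walk  : WalkFrom G v₀ (v₀ ∷ rest)
    dist  : Unique (v₀ ∷ rest)
    close : Adj G (last v₀ rest) v₀

Acyclic : ∀ {n} → Graph n → Set
Acyclic G = ¬ Cycle G

Tree : ∀ {n} → Graph n → Set
Tree {n} G = (1 ≤ n) × Connected G × Acyclic G

Dominating : ∀ {n} → Graph n → Subset n → Set
Dominating {n} G S = ∀ (v : Fin n) → v ∈ S ⊎ (∃[ u ] (u ∈ S × Adj G u v))

IsDominationNumber : ∀ {n} → Graph n → ℕ → Set
IsDominationNumber {n} G k =
  (∃[ S ] (Dominating G S × Data.Fin.Subset.∣ S ∣ ≡ k)) ×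
  (∀ S → Dominating G S → k ≤ Data.Fin.Subset.∣ S ∣)

Critical : ∀ {n} → Graph n → Subset n → Fin n → Set
Critical G S v = v ∈ S × ¬ Dominating G (S - v)

IsCriticalSet : ∀ {n} → Graph n → Subset n → Subset n → Set
IsCriticalSet {n} G S A = ∀ (v : Fin n) → (v ∈ A → Critical G S v) × (Critical G S v → v ∈ A)

{-# OPTIONS --safe #-}
module Submission where

-- Each vertex r is dominated by a critical vertex of S, or by two distinct
-- non-critical ones s, s′ (as S - s still dominates r). Root the tree and
-- colour it top-down, changing colour at every vertex x except when x is the
-- chosen non-critical child of a non-critical parent; then every closed
-- neighbourhood containing two non-critical vertices of S sees both colours.
-- With X a colour class, A ∪ (S ∩ X) and A ∪ (S ∖ X) are dominating sets of
-- total size |A| + |S|, so 2γ ≤ |A| + |S|.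

open import Defs hiding (sym)
open import Data.Bool using (Bool; true; false; not; _xor_; T; T?)
open import Data.Empty using (⊥; ⊥-elim)
open import Data.Fin using (Fin; zero; suc; _≟_)
open import Data.Fin.Properties using (any?; all?)
open import Data.Fin.Subset using (Subset; inside; outside; ∣_∣; _∈_; _∉_; _⊆_; _∪_; _∩_; ∁; _─_; _-_)
open import Data.Fin.Subset.Properties
  using (_∈?_; x∈p∪q⁺; x∈p∪q⁻; x∈p∩q⁺; x∉p⇒x∈∁p; p─⊥≡p; p─q⊆p; x∈p∧x∉q⇒x∈p─q; p⊆q⇒∣p∣≤∣q∣)
open import Data.List using (List; []; _∷_; _++_; length)
open import Data.List.Relation.Unary.All using (All; []; _∷_)
import Data.List.Relation.Unary.All as All
import Data.List.Relation.Unary.All.Properties as All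
open import Data.List.Relation.Unary.AllPairs using ([]; _∷_)
import Data.List.Relation.Unary.AllPairs.Properties as AllPairs
open import Data.List.Relation.Unary.Unique.Propositional using (Unique)
open import Data.Nat using (ℕ; zero; suc; _+_; _*_; _∸_; _≤_; _<_; z≤n; s≤s)
open import Data.Nat.Properties
  using (≤-refl; ≤-reflexive; ≤-antisym; ≤-pred; <⇒≤; <⇒≢; <-cmp; +-suc; +-comm; +-identityʳ;
         +-mono-≤; +-monoʳ-≤; m≤n+o⇒m∸n≤o; module ≤-Reasoning)
open import Data.Product using (_×_; _,_; proj₁; proj₂; ∃-syntax; ∃₂)
open import Data.Sum using (_⊎_; inj₁; inj₂; [_,_])
open import Data.Vec using ([]; _∷_; tabulate; here; there)
open import Data.Vec.Properties using ([]=⇒lookup; lookup⇒[]=; lookup∘tabulate)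
open import Function using (_∘_; id)
open import Level using (0ℓ)
open import Relation.Binary.Definitions using (tri<; tri≈; tri>)
open import Relation.Binary.PropositionalEquality using (_≡_; _≢_; refl; sym; trans; cong; subst)
open import Relation.Nullary using (Dec; yes; no; does; ¬_; contradiction)
open import Relation.Nullary.Decidable using (_⊎-dec_; _×-dec_; ¬?; decidable-stable; dec-true; dec-false)
open import Relation.Unary using (Pred; Decidable)

least-witness : {P : Pred ℕ 0ℓ} → Decidable P → ∀ {m} → P m → ∃[ k ] (P k × ∀ {j} → P j → k ≤ j)
least-witness P? {zero} p = zero , p , λ _ → z≤n
least-witness P? {suc m} p with P? zero
... | yes p₀ = zero , p₀ , λ _ → z≤n
... | no ¬p₀ with least-witness (P? ∘ suc) p
...   | k , pk , minimal = suc k , pk , λ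
  { {zero}  p₀ → contradiction p₀ ¬p₀
  ; {suc j} pj → s≤s (minimal pj) }

avoid : ∀ {n} {P : Pred (Fin n) 0ℓ} {s s′} → s ≢ s′ → P s → P s′ → ∀ z → ∃[ w ] (P w × w ≢ z)
avoid {s = s} s≢s′ ps ps′ z with s ≟ z
... | yes refl = _ , ps′ , s≢s′ ∘ sym
... | no s≢z   = _ , ps , s≢z

x∈p-y⁻ : ∀ {n} (p : Subset n) {x y : Fin n} → x ∈ p - y → x ∈ p × x ≢ y
x∈p-y⁻ (_ ∷ p) {zero}  {zero}  ()
x∈p-y⁻ (_ ∷ p) {suc x} {zero}  (there x∈p-y) = there (subst (x ∈_) (p─⊥≡p p) x∈p-y) , λ ()
x∈p-y⁻ (_ ∷ p) {zero}  {suc y} here          = here , λ ()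
x∈p-y⁻ (_ ∷ p) {suc x} {suc y} (there x∈p-y) with x∈p-y⁻ p x∈p-y
... | x∈p , x≢y = there x∈p , λ { refl → x≢y refl }

+-suc-cong : ∀ {a b c d} → a + b ≡ c + d → a + suc b ≡ c + suc d
+-suc-cong {a} {b} {c} {d} eq = trans (+-suc a b) (trans (cong suc eq) (sym (+-suc c d)))

∣p∪q∩r∣+∣p∪q∩∁r∣≡∣p∣+∣p∪q∣ : ∀ {n} (p q r : Subset n) →
  ∣ p ∪ q ∩ r ∣ + ∣ p ∪ q ∩ ∁ r ∣ ≡ ∣ p ∣ + ∣ p ∪ q ∣
∣p∪q∩r∣+∣p∪q∩∁r∣≡∣p∣+∣p∪q∣ []            []            []            = refl
∣p∪q∩r∣+∣p∪q∩∁r∣≡∣p∣+∣p∪q∣ (inside  ∷ p) (_ ∷ q)       (_ ∷ r)       =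
  cong suc (+-suc-cong (∣p∪q∩r∣+∣p∪q∩∁r∣≡∣p∣+∣p∪q∣ p q r))
∣p∪q∩r∣+∣p∪q∩∁r∣≡∣p∣+∣p∪q∣ (outside ∷ p) (inside  ∷ q) (inside  ∷ r) =
  trans (cong suc (∣p∪q∩r∣+∣p∪q∩∁r∣≡∣p∣+∣p∪q∣ p q r)) (sym (+-suc ∣ p ∣ ∣ p ∪ q ∣))
∣p∪q∩r∣+∣p∪q∩∁r∣≡∣p∣+∣p∪q∣ (outside ∷ p) (inside  ∷ q) (outside ∷ r) =
  +-suc-cong (∣p∪q∩r∣+∣p∪q∩∁r∣≡∣p∣+∣p∪q∣ p q r)
∣p∪q∩r∣+∣p∪q∩∁r∣≡∣p∣+∣p∪q∣ (outside ∷ p) (outside ∷ q) (_ ∷ r)       = ∣p∪q∩r∣+∣p∪q∩∁r∣≡∣p∣+∣p∪q∣ p q r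

Splits : ∀ {n} → Subset n → Pred (Fin n) 0ℓ → Set
Splits X P = ∃₂ λ x y → P x × P y × x ∈ X × y ∉ X

module _ {n} (G : Graph n) where

  adj-sym : ∀ {u v} → Adj G u v → Adj G v u
  adj-sym {u} {v} = subst T (Graph.sym G u v)

  adj⇒≢ : ∀ {u v} → Adj G u v → u ≢ v
  adj⇒≢ {u} a refl = subst T (irrefl G u) a

  Dominates : Fin n → Fin n → Set
  Dominates u v = u ≡ v ⊎ Adj G u v

  dominating⁻ : ∀ {S} → Dominating G S → ∀ v → ∃[ u ] (u ∈ S × Dominates u v)
  dominating⁻ S-dom v with S-dom v
  ... | inj₁ v∈S           = v , v∈S , inj₁ refl
  ... | inj₂ (u , u∈S , a) = u , u∈S , inj₂ a

  dominating⁺ : ∀ {S} → (∀ v → ∃[ u ] (u ∈ S × Dominates u v)) → Dominating G S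
  dominating⁺ dom v with dom v
  ... | u , u∈S , inj₁ refl = inj₁ u∈S
  ... | u , u∈S , inj₂ a    = inj₂ (u , u∈S , a)

  dominating? : ∀ S → Dec (Dominating G S)
  dominating? S = all? λ v → v ∈? S ⊎-dec any? λ u → u ∈? S ×-dec T? (adj G u v)

  critical⊆ : ∀ {S A} → IsCriticalSet G S A → A ⊆ S
  critical⊆ A-crit x∈A = proj₁ (proj₁ (A-crit _) x∈A)

  noncritical-removable : ∀ {S A s} → IsCriticalSet G S A → s ∈ S → s ∉ A → Dominating G (S - s)
  noncritical-removable {S} {s = s} A-crit s∈S s∉A =
    decidable-stable (dominating? (S - s)) λ ¬dom → s∉A (proj₂ (A-crit s) (s∈S , ¬dom))

  critical-or-two-noncritical : ∀ {S A} → Dominating G S → IsCriticalSet G S A → ∀ r →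
    (∃[ a ] (a ∈ A × Dominates a r)) ⊎
    (∃₂ λ s s′ → s ≢ s′ × s ∈ S ─ A × s′ ∈ S ─ A × Dominates s r × Dominates s′ r)
  critical-or-two-noncritical {S} {A} S-dom A-crit r with dominating⁻ S-dom r
  ... | s , s∈S , s→r with s ∈? A
  ...   | yes s∈A = inj₁ (s , s∈A , s→r)
  ...   | no s∉A with dominating⁻ (noncritical-removable A-crit s∈S s∉A) r
  ...     | s′ , s′∈S-s , s′→r with x∈p-y⁻ S s′∈S-s | s′ ∈? A
  ...       | _ , _ | yes s′∈A = inj₁ (s′ , s′∈A , s′→r)
  ...       | s′∈S , s′≢s | no s′∉A =
    inj₂ (s , s′ , s′≢s ∘ sym , x∈p∧x∉q⇒x∈p─q s∈S s∉A , x∈p∧x∉q⇒x∈p─q s′∈S s′∉A , s→r , s′→r)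

  halves-dominating : ∀ {A S X} →
    (∀ r → (∃[ a ] (a ∈ A × Dominates a r)) ⊎ Splits X (λ x → x ∈ S × Dominates x r)) →
    Dominating G (A ∪ S ∩ X) × Dominating G (A ∪ S ∩ ∁ X)
  halves-dominating {A} {S} {X} cover = dominating⁺ inside-X , dominating⁺ outside-X
    where
    via-A : ∀ {Y r} → ∃[ a ] (a ∈ A × Dominates a r) → ∃[ u ] (u ∈ A ∪ Y × Dominates u r)
    via-A (a , a∈A , a→r) = a , x∈p∪q⁺ (inj₁ a∈A) , a→r

    via-S : ∀ {Y r x} → x ∈ S × Dominates x r → x ∈ Y → ∃[ u ] (u ∈ A ∪ S ∩ Y × Dominates u r)
    via-S (x∈S , x→r) x∈Y = _ , x∈p∪q⁺ (inj₂ (x∈p∩q⁺ (x∈S , x∈Y))) , x→r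

    inside-X : ∀ r → ∃[ u ] (u ∈ A ∪ S ∩ X × Dominates u r)
    inside-X r = [ via-A , (λ (_ , _ , x∈N , _ , x∈X , _) → via-S x∈N x∈X) ] (cover r)

    outside-X : ∀ r → ∃[ u ] (u ∈ A ∪ S ∩ ∁ X × Dominates u r)
    outside-X r = [ via-A , (λ (_ , _ , _ , y∈N , _ , y∉X) → via-S y∈N (x∉p⇒x∈∁p y∉X)) ] (cover r)

record Rooting {n} (G : Graph n) : Set where
  field
    parent       : Fin n → Fin n
    depth        : Fin n → ℕ
    parent-adj   : ∀ {v} → parent v ≢ v → Adj G v (parent v)
    depth-parent : ∀ {v} → parent v ≢ v → depth v ≡ suc (depth (parent v))
    adj⇒parent   : ∀ {u w} → Adj G u w → parent u ≡ w ⊎ parent w ≡ u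

module NeighbourhoodColouring {n} {G : Graph n} (R : Rooting G) (B : Subset n) where
  open Rooting R

  Child : Fin n → Fin n → Set
  Child r c = c ∈ B × parent c ≡ r × c ≢ r

  child? : ∀ r → Dec (∃[ c ] Child r c)
  child? r = any? λ c → c ∈? B ×-dec parent c ≟ r ×-dec ¬? (c ≟ r)

  leader : Fin n → Fin n
  leader r with child? r
  ... | yes (c , _) = c
  ... | no _        = r

  leader-child : ∀ {r c} → Child r c → Child r (leader r)
  leader-child {r} {c} child with child? r
  ... | yes (_ , child′) = child′
  ... | no none          = contradiction (c , child) none

  Flips : Fin n → Set
  Flips x = parent x ∈ B ⊎ x ≢ leader (parent x)

  flips? : ∀ x → Dec (Flips x)
  flips? x = parent x ∈? B ⊎-dec ¬? (x ≟ leader (parent x))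

  colourAt : ℕ → Fin n → Bool
  colourAt zero    x = false
  colourAt (suc k) x = does (flips? x) xor colourAt k (parent x)

  colour : Fin n → Bool
  colour x = colourAt (depth x) x

  colour-step : ∀ {x} → parent x ≢ x → colour x ≡ does (flips? x) xor colour (parent x)
  colour-step px≢x rewrite depth-parent px≢x = refl

  colour-flip : ∀ {x y} → parent x ≡ y → x ≢ y → Flips x → colour x ≡ not (colour y)
  colour-flip {x} refl x≢px flips =
    trans (colour-step (x≢px ∘ sym)) (cong (_xor colour (parent x)) (dec-true (flips? x) flips))

  colour-keep : ∀ {x y} → parent x ≡ y → x ≢ y → ¬ Flips x → colour x ≡ colour y
  colour-keep {x} refl x≢px ¬flips =
    trans (colour-step (x≢px ∘ sym)) (cong (_xor colour (parent x)) (dec-false (flips? x) ¬flips))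

  Coloured : Subset n
  Coloured = tabulate colour

  ∈Coloured : ∀ {x} → colour x ≡ true → x ∈ Coloured
  ∈Coloured {x} eq = lookup⇒[]= x Coloured (trans (lookup∘tabulate colour x) eq)

  ∉Coloured : ∀ {x} → colour x ≡ false → x ∉ Coloured
  ∉Coloured {x} eq x∈X with trans (sym ([]=⇒lookup x∈X)) (trans (lookup∘tabulate colour x) eq)
  ... | ()

  split-by-colour : ∀ {P : Pred (Fin n) 0ℓ} {x y} → P x → P y → colour x ≡ not (colour y) →
    Splits Coloured P
  split-by-colour {y = y} px py eq with colour y in cy
  ... | true  = _ , _ , py , px , ∈Coloured cy , ∉Coloured eq
  ... | false = _ , _ , px , py , ∈Coloured eq , ∉Coloured cy

  InNeighbourhood : Fin n → Pred (Fin n) 0ℓ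
  InNeighbourhood r x = x ∈ B × Dominates G x r

  child-dominates : ∀ {r c} → Child r c → Dominates G c r
  child-dominates (_ , refl , c≢pc) = inj₂ (parent-adj (c≢pc ∘ sym))

  child-of-nonmember : ∀ {r x} → r ∉ B → parent r ≢ x → InNeighbourhood r x → Child r x
  child-of-nonmember r∉B pr≢x (x∈B , inj₁ refl) = contradiction x∈B r∉B
  child-of-nonmember r∉B pr≢x (x∈B , inj₂ a) with adj⇒parent a
  ... | inj₁ px≡r = x∈B , px≡r , adj⇒≢ G a
  ... | inj₂ pr≡x = contradiction pr≡x pr≢x

  leader-keeps-colour : ∀ {r} → r ∉ B → Child r (leader r) → colour (leader r) ≡ colour r
  leader-keeps-colour {r} r∉B (_ , pc≡r , c≢r) = colour-keep pc≡r c≢r λ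
    { (inj₁ pc∈B) → r∉B (subst (_∈ B) pc≡r pc∈B)
    ; (inj₂ c≢lpc) → c≢lpc (cong leader (sym pc≡r)) }

  others-flip : ∀ {r w} → Child r w → w ≢ leader r → colour w ≡ not (colour r)
  others-flip (_ , refl , w≢pw) w≢l = colour-flip refl w≢pw (inj₂ w≢l)

  split-at-member : ∀ {r z} → r ∈ B → InNeighbourhood r z → z ≢ r → Splits Coloured (InNeighbourhood r)
  split-at-member r∈B (z∈B , inj₁ z≡r) z≢r = contradiction z≡r z≢r
  split-at-member r∈B (z∈B , inj₂ a) z≢r with adj⇒parent a
  ... | inj₁ refl = split-by-colour (z∈B , inj₂ a) (r∈B , inj₁ refl) (colour-flip refl z≢r (inj₁ r∈B))
  ... | inj₂ refl =
    split-by-colour (r∈B , inj₁ refl) (z∈B , inj₂ a) (colour-flip refl (z≢r ∘ sym) (inj₁ z∈B))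

  split-below-member : ∀ {r c} → r ∉ B → parent r ∈ B → Child r c → Splits Coloured (InNeighbourhood r)
  split-below-member {r} r∉B pr∈B child =
    split-by-colour (proj₁ leads , child-dominates leads) (pr∈B , inj₂ (adj-sym G (parent-adj pr≢r)))
      (trans (leader-keeps-colour r∉B leads) (colour-flip refl (pr≢r ∘ sym) (inj₁ pr∈B)))
    where
    leads = leader-child child
    pr≢r : parent r ≢ r
    pr≢r pr≡r = r∉B (subst (_∈ B) pr≡r pr∈B)

  split-below-nonmember : ∀ {r s s′} → r ∉ B → parent r ∉ B → s ≢ s′ →
    InNeighbourhood r s → InNeighbourhood r s′ → Splits Coloured (InNeighbourhood r)
  split-below-nonmember {r} r∉B pr∉B s≢s′ s∈N s′∈N with avoid s≢s′ s∈N s′∈N (leader r)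
  ... | w , w∈N , w≢l =
    split-by-colour w∈N (proj₁ leads , child-dominates leads)
      (trans (others-flip (child-of-nonmember r∉B (outside-B w∈N) w∈N) w≢l)
             (cong not (sym (leader-keeps-colour r∉B leads))))
    where
    outside-B : ∀ {x} → InNeighbourhood r x → parent r ≢ x
    outside-B (x∈B , _) pr≡x = pr∉B (subst (_∈ B) (sym pr≡x) x∈B)
    leads = leader-child (child-of-nonmember r∉B (outside-B s∈N) s∈N)

  neighbourhood-split : ∀ r {s s′} → s ≢ s′ → InNeighbourhood r s → InNeighbourhood r s′ →
    Splits Coloured (InNeighbourhood r)
  neighbourhood-split r s≢s′ s∈N s′∈N with r ∈? B | parent r ∈? B
  ... | yes r∈B | _ with avoid s≢s′ s∈N s′∈N r
  ...   | z , z∈N , z≢r = split-at-member r∈B z∈N z≢r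
  neighbourhood-split r s≢s′ s∈N s′∈N | no r∉B | yes pr∈B with avoid s≢s′ s∈N s′∈N (parent r)
  ...   | w , w∈N , w≢pr = split-below-member r∉B pr∈B (child-of-nonmember r∉B (w≢pr ∘ sym) w∈N)
  neighbourhood-split r s≢s′ s∈N s′∈N | no r∉B | no pr∉B = split-below-nonmember r∉B pr∉B s≢s′ s∈N s′∈N

last-snoc : ∀ {A : Set} (a : A) xs b → last a (xs ++ b ∷ []) ≡ b
last-snoc a []       b = refl
last-snoc a (x ∷ xs) b = last-snoc x xs b

record Path {n} (G : Graph n) (u v : Fin n) : Set where
  field
    rest   : List (Fin n)
    walk   : WalkFrom G u (u ∷ rest)
    ends   : last u rest ≡ v
    simple : Unique (u ∷ rest)

  vertices : List (Fin n)
  vertices = u ∷ rest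

open Path

module _ {n} {G : Graph n} where

  walk-snoc : ∀ {u w} vs → WalkFrom G u (u ∷ vs) → Adj G (last u vs) w → WalkFrom G u (u ∷ vs ++ w ∷ [])
  walk-snoc []       (single _)   a = step a (single _)
  walk-snoc (v ∷ vs) (step a′ vw) a = step a′ (walk-snoc vs vw a)

  edge : ∀ {u v} → Adj G u v → Path G u v
  edge {v = v} a = record
    { rest = v ∷ [] ; walk = step a (single v) ; ends = refl ; simple = (adj⇒≢ G a ∷ []) ∷ [] ∷ [] }

  prepend : ∀ {u v w} → Adj G w u → (P : Path G u v) → All (w ≢_) (vertices P) → Path G w v
  prepend a P fresh = record
    { rest = vertices P ; walk = step a (walk P) ; ends = ends P ; simple = fresh ∷ simple P }

  append : ∀ {u v w} (P : Path G u v) → Adj G v w → All (_≢ w) (vertices P) → Path G u w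
  append {u} {w = w} P a fresh = record
    { rest   = rest P ++ w ∷ []
    ; walk   = walk-snoc (rest P) (walk P) (subst (λ x → Adj G x w) (sym (ends P)) a)
    ; ends   = last-snoc u (rest P) w
    ; simple = AllPairs.++⁺ (simple P) ([] ∷ []) (All.map (_∷ []) fresh)
    }

  nontrivial : ∀ {u v} (P : Path G u v) → u ≢ v → 1 ≤ length (rest P)
  nontrivial P u≢v with rest P | ends P
  ... | []    | u≡v = contradiction u≡v u≢v
  ... | _ ∷ _ | _   = s≤s z≤n

  close : ∀ {u v} (P : Path G u v) → 2 ≤ length (rest P) → Adj G v u → Cycle G
  close {u} P long a = record
    { v₀ = u ; rest = rest P ; long = long ; walk = walk P ; dist = simple P
    ; close = subst (λ x → Adj G x u) (sym (ends P)) a }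

module BreadthFirst {n} (G : Graph n) (ρ : Fin n) (connected : Connected G) (acyclic : Acyclic G) where

  WalkToRoot : ℕ → Fin n → Set
  WalkToRoot zero    v = v ≡ ρ
  WalkToRoot (suc k) v = ∃[ u ] (Adj G v u × WalkToRoot k u)

  walkToRoot? : ∀ k v → Dec (WalkToRoot k v)
  walkToRoot? zero    v = v ≟ ρ
  walkToRoot? (suc k) v = any? λ u → T? (adj G v u) ×-dec walkToRoot? k u

  walkFrom⇒walkToRoot : ∀ {v} vs → WalkFrom G v (v ∷ vs) → last v vs ≡ ρ → WalkToRoot (length vs) v
  walkFrom⇒walkToRoot []       (single _)  ends = ends
  walkFrom⇒walkToRoot (w ∷ ws) (step a vw) ends = w , a , walkFrom⇒walkToRoot ws vw ends

  shortest : ∀ v → ∃[ k ] (WalkToRoot k v × ∀ {j} → WalkToRoot j v → k ≤ j)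
  shortest v with connected v ρ
  ... | vs , vw , ends = least-witness (λ k → walkToRoot? k v) (walkFrom⇒walkToRoot vs vw ends)

  depth : Fin n → ℕ
  depth v = proj₁ (shortest v)

  depth-walk : ∀ v → WalkToRoot (depth v) v
  depth-walk v = proj₁ (proj₂ (shortest v))

  depth-minimal : ∀ {v j} → WalkToRoot j v → depth v ≤ j
  depth-minimal {v} = proj₂ (proj₂ (shortest v))

  depth-zero : ∀ {v} → depth v ≡ 0 → v ≡ ρ
  depth-zero {v} eq = subst (λ k → WalkToRoot k v) eq (depth-walk v)

  depth-adj : ∀ {u v} → Adj G u v → depth u ≤ suc (depth v)
  depth-adj a = depth-minimal (_ , a , depth-walk _)

  next : ∀ {k v} → WalkToRoot k v → Fin n
  next {zero}  {v} _       = v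
  next {suc k}     (u , _) = u

  next-root : ∀ {k v} (w : WalkToRoot k v) → k ≡ 0 → next w ≡ v
  next-root {zero} _ refl = refl

  next-step : ∀ {j k v} (w : WalkToRoot j v) → j ≡ suc k → Adj G v (next w) × WalkToRoot k (next w)
  next-step (_ , a , w) refl = a , w

  parent : Fin n → Fin n
  parent v = next (depth-walk v)

  parent-step : ∀ {v k} → depth v ≡ suc k → Adj G v (parent v) × depth (parent v) ≡ k
  parent-step {v} {k} eq with next-step (depth-walk v) eq
  ... | v↑ , w =
    v↑ , ≤-antisym (depth-minimal w) (≤-pred (subst (_≤ suc (depth (parent v))) eq (depth-adj v↑)))

  nonroot-depth : ∀ {v} → parent v ≢ v → ∃[ k ] (depth v ≡ suc k)
  nonroot-depth {v} pv≢v = by-cases (depth v) refl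
    where
    by-cases : ∀ j → depth v ≡ j → ∃[ k ] (depth v ≡ suc k)
    by-cases zero    eq = contradiction (next-root (depth-walk v) eq) pv≢v
    by-cases (suc k) eq = k , eq

  deeper-≢ : ∀ {k x w} → suc k ≤ depth x → depth w ≡ k → x ≢ w
  deeper-≢ k<dx dw x≡w = <⇒≢ k<dx (trans (sym dw) (cong depth (sym x≡w)))

  -- Replace both ends by their parents, one level up: equal parents close a cycle with
  -- the path, distinct ones are joined by a longer path that still stays at depth ≥ k.
  no-deep-path : ∀ k {a b} → depth a ≡ k → depth b ≡ k → a ≢ b →
    (P : Path G b a) → All (λ x → k ≤ depth x) (vertices P) → ⊥
  no-deep-path zero    da db a≢b P deep = a≢b (trans (depth-zero da) (sym (depth-zero db)))
  no-deep-path (suc k) {a} {b} da db a≢b P deep with parent-step da | parent-step db | parent a ≟ parent b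
  ... | a↑ , dpa | b↑ , dpb | yes pa≡pb =
    acyclic (close (prepend (adj-sym G b↑) P pb-fresh) (s≤s (nontrivial P (a≢b ∘ sym)))
                   (subst (Adj G a) pa≡pb a↑))
    where
    pb-fresh = All.map (λ k<dx pb≡x → deeper-≢ k<dx dpb (sym pb≡x)) deep
  ... | a↑ , dpa | b↑ , dpb | no pa≢pb =
    no-deep-path k dpa dpb pa≢pb (prepend (adj-sym G b↑) (append P a↑ pa-fresh) pb-fresh) deep′
    where
    pa-fresh = All.map (λ k<dx → deeper-≢ k<dx dpa) deep
    pb-fresh = All.++⁺ (All.map (λ k<dx pb≡x → deeper-≢ k<dx dpb (sym pb≡x)) deep) (pa≢pb ∘ sym ∷ [])
    deep′ = ≤-reflexive (sym dpb) ∷ All.++⁺ (All.map <⇒≤ deep) (≤-reflexive (sym dpa) ∷ [])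

  adj⇒depth≢ : ∀ {u w} → Adj G u w → depth u ≢ depth w
  adj⇒depth≢ {u} a du≡dw =
    no-deep-path (depth u) refl (sym du≡dw) (adj⇒≢ G a) (edge (adj-sym G a))
                 (≤-reflexive du≡dw ∷ ≤-refl ∷ [])

  adj-deeper⇒parent : ∀ {u w} → Adj G u w → depth u < depth w → parent w ≡ u
  adj-deeper⇒parent {u} {w} a du<dw with parent w ≟ u
  ... | yes pw≡u = pw≡u
  ... | no pw≢u  = ⊥-elim (no-deep-path (depth u) (proj₂ w↑) refl pw≢u
                            (append (edge a) (proj₁ w↑) (pw≢u ∘ sym ∷ adj⇒≢ G (proj₁ w↑) ∷ []))
                            (≤-refl ∷ <⇒≤ du<dw ∷ ≤-reflexive (sym (proj₂ w↑)) ∷ []))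
    where
    w↑ = parent-step (≤-antisym (depth-adj (adj-sym G a)) du<dw)

  adj⇒parent : ∀ {u w} → Adj G u w → parent u ≡ w ⊎ parent w ≡ u
  adj⇒parent {u} {w} a with <-cmp (depth u) (depth w)
  ... | tri< du<dw _ _ = inj₂ (adj-deeper⇒parent a du<dw)
  ... | tri≈ _ du≡dw _ = ⊥-elim (adj⇒depth≢ a du≡dw)
  ... | tri> _ _ dw<du = inj₁ (adj-deeper⇒parent (adj-sym G a) dw<du)

  rooting : Rooting G
  rooting = record
    { parent       = parent
    ; depth        = depth
    ; parent-adj   = λ pv≢v → proj₁ (parent-step (proj₂ (nonroot-depth pv≢v)))
    ; depth-parent = λ pv≢v → let k , dv≡1+k = nonroot-depth pv≢v in
                       trans dv≡1+k (cong suc (sym (proj₂ (parent-step dv≡1+k))))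
    ; adj⇒parent   = adj⇒parent
    }

tree-rooting : ∀ {n} {G : Graph n} → Tree G → Rooting G
tree-rooting {G = G} (s≤s z≤n , connected , acyclic) = BreadthFirst.rooting G zero connected acyclic

critical-or-split : ∀ {n} {G : Graph n} {S A} → Tree G → Dominating G S → IsCriticalSet G S A →
  ∃[ X ] ∀ r → (∃[ a ] (a ∈ A × Dominates G a r)) ⊎ Splits X (λ x → x ∈ S × Dominates G x r)
critical-or-split {G = G} {S} {A} tree S-dom A-crit = Coloured , cover
  where
  open NeighbourhoodColouring (tree-rooting tree) (S ─ A)
  cover : ∀ r → (∃[ a ] (a ∈ A × Dominates G a r)) ⊎ Splits Coloured (λ x → x ∈ S × Dominates G x r)
  cover r with critical-or-two-noncritical G S-dom A-crit r
  ... | inj₁ critical = inj₁ critical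
  ... | inj₂ (s , s′ , s≢s′ , s∈B , s′∈B , s→r , s′→r)
    with neighbourhood-split r s≢s′ (s∈B , s→r) (s′∈B , s′→r)
  ... | x , y , (x∈B , x→r) , (y∈B , y→r) , x∈X , y∉X =
    inj₂ (x , y , (p─q⊆p S A x∈B , x→r) , (p─q⊆p S A y∈B , y→r) , x∈X , y∉X)

lemma5 : ∀ {n} (T : Graph n) → Tree T →
    ∀ (γ : ℕ) → IsDominationNumber T γ →
    ∀ (S : Subset n) → Dominating T S →
    ∀ (A : Subset n) → IsCriticalSet T S A →
    2 * γ ∸ ∣ S ∣ ≤ ∣ A ∣
lemma5 T tree γ (_ , γ-minimal) S S-dom A A-crit = m≤n+o⇒m∸n≤o (2 * γ) ∣ S ∣ (begin
  2 * γ                               ≡⟨ cong (γ +_) (+-identityʳ γ) ⟩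
  γ + γ                               ≤⟨ +-mono-≤ (γ-minimal _ D₁-dom) (γ-minimal _ D₂-dom) ⟩
  ∣ A ∪ S ∩ X ∣ + ∣ A ∪ S ∩ ∁ X ∣      ≡⟨ ∣p∪q∩r∣+∣p∪q∩∁r∣≡∣p∣+∣p∪q∣ A S X ⟩
  ∣ A ∣ + ∣ A ∪ S ∣                    ≤⟨ +-monoʳ-≤ ∣ A ∣ (p⊆q⇒∣p∣≤∣q∣ A∪S⊆S) ⟩
  ∣ A ∣ + ∣ S ∣                        ≡⟨ +-comm ∣ A ∣ ∣ S ∣ ⟩
  ∣ S ∣ + ∣ A ∣                        ∎)
  where
  open ≤-Reasoning
  split = critical-or-split tree S-dom A-crit
  X = proj₁ split
  D₁-dom = proj₁ (halves-dominating T (proj₂ split))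
  D₂-dom = proj₂ (halves-dominating T (proj₂ split))
  A∪S⊆S : A ∪ S ⊆ S
  A∪S⊆S x∈A∪S = [ critical⊆ T A-crit , id ] (x∈p∪q⁻ A S x∈A∪S)
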